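{- Let $a_0,\dots,a_{15}\in\mathbb{Z}$, with $c_k$ and $\alpha_2$ as in the context. If $c_0\not\equiv c_2$ and $c_1\not\equiv c_3\pmod 2$, then $$\Re(\alpha_2)\equiv(-1)^{c_2}+2(c_0c_2+c_1c_3)\pmod 8,\qquad \Im(\alpha_2)\equiv(-1)^{c_1}+2(c_0c_2+c_1c_3)\pmod 8.$$
   Context: Let $f(x)=\sum_{k=0}^{15}a_kx^k$, $\zeta_8=e^{2\pi\sqrt{ -1}/8}$, and $\alpha_2:=f(\zeta_8)f(\zeta_8^5)$ (an element of $\mathbb{Z}[\sqrt{ -1}]$). For $0\le k\le 3$, $c_k := (a_k+a_{k+8})-(a_{k+4}+a_{k+12})$. -}

module Defs where

open import Data.Nat using (ℕ; zero; suc)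
open import Data.Integer using (ℤ; +_; -_; _+_; _*_; _-_; _^_; ∣_∣)
open import Data.Integer.Divisibility using (_∣_)
open import Data.Fin using (Fin; toℕ; #_)
open import Data.List using (List; allFin; foldr; map)
open import Relation.Nullary using (¬_)

-- ℤ[ζ₈] = ℤ[x]/(x⁴+1), an element c0 + c1 ζ + c2 ζ² + c3 ζ³ (ζ = ζ₈, ζ² = √-1).
record ℤζ₈ : Set where
  constructor ⟨_,_,_,_⟩
  field
    r0 r1 r2 r3 : ℤ
open ℤζ₈ public

infixl 6 _⊕_
infixl 7 _⊗_

_⊕_ : ℤζ₈ → ℤζ₈ → ℤζ₈
⟨ a0 , a1 , a2 , a3 ⟩ ⊕ ⟨ b0 , b1 , b2 , b3 ⟩ = ⟨ a0 + b0 , a1 + b1 , a2 + b2 , a3 + b3 ⟩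

-- multiplication using ζ⁴ = -1
_⊗_ : ℤζ₈ → ℤζ₈ → ℤζ₈
⟨ a0 , a1 , a2 , a3 ⟩ ⊗ ⟨ b0 , b1 , b2 , b3 ⟩ =
  ⟨ a0 * b0 - (a1 * b3 + a2 * b2 + a3 * b1)
  , a0 * b1 + a1 * b0 - (a2 * b3 + a3 * b2)
  , a0 * b2 + a1 * b1 + a2 * b0 - a3 * b3
  , a0 * b3 + a1 * b2 + a2 * b1 + a3 * b0 ⟩

𝟘 𝟙 ζ₈ : ℤζ₈
𝟘 = ⟨ + 0 , + 0 , + 0 , + 0 ⟩
𝟙 = ⟨ + 1 , + 0 , + 0 , + 0 ⟩
ζ₈ = ⟨ + 0 , + 1 , + 0 , + 0 ⟩

ι : ℤ → ℤζ₈
ι n = ⟨ n , + 0 , + 0 , + 0 ⟩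

pow : ℤζ₈ → ℕ → ℤζ₈
pow x zero = 𝟙
pow x (suc n) = x ⊗ pow x n

evalF : (Fin 16 → ℤ) → ℤζ₈ → ℤζ₈
evalF a x = foldr _⊕_ 𝟘 (map (λ k → ι (a k) ⊗ pow x (toℕ k)) (allFin 16))

α₂ : (Fin 16 → ℤ) → ℤζ₈
α₂ a = evalF a ζ₈ ⊗ evalF a (pow ζ₈ 5)

-- Real and imaginary parts of an element of ℤ[√-1] = ℤ[ζ₈²] ⊂ ℤ[ζ₈]
Re Im : ℤζ₈ → ℤ
Re z = r0 z
Im z = r2 z

c₀ c₁ c₂ c₃ : (Fin 16 → ℤ) → ℤ
c₀ a = (a (# 0) + a (# 8)) - (a (# 4) + a (# 12))
c₁ a = (a (# 1) + a (# 9)) - (a (# 5) + a (# 13))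
c₂ a = (a (# 2) + a (# 10)) - (a (# 6) + a (# 14))
c₃ a = (a (# 3) + a (# 11)) - (a (# 7) + a (# 15))

_≡_[mod_] : ℤ → ℤ → ℕ → Set
x ≡ y [mod m ] = (+ m) ∣ (x - y)

-- (-1)^c for c ∈ ℤ (depends only on the parity of c)
negOnePow : ℤ → ℤ
negOnePow c = (- (+ 1)) ^ ∣ c ∣

{-# OPTIONS --safe #-}
-- Since ζ₈⁴ = -1, f(ζ₈) = c₀ + c₁ζ₈ + c₂ζ₈² + c₃ζ₈³, and f(ζ₈⁵) = f(-ζ₈) is its image
-- under ζ₈ ↦ -ζ₈; hence Re α₂ = c₀² - c₂² + 2c₁c₃ and Im α₂ = 2c₀c₂ - c₁² + c₃².
-- Both claims then reduce to x² - z² - 2xz ≡ (-1)^z (mod 8) whenever x - z is odd,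
-- which follows from x² - z² - 2xz = (x - z)² - 2z², an odd square being 1 mod 8,
-- and 1 - 2z² ≡ (-1)^z (mod 8).
module Submission where

open import Defs
open import Data.Fin using (Fin; #_)
open import Data.Integer using (ℤ; +_; -[1+_]; -_; _+_; _*_; _-_; _^_; ∣_∣)
open import Data.Integer.Divisibility using (_∣_)
open import Data.Integer.Divisibility.Signed as Signed
  using (divides; ∣ᵤ⇒∣; ∣⇒∣ᵤ; ∣m∣n⇒∣m+n; ∣m∣n⇒∣m-n)
open import Data.Integer.Properties using (∣-i∣≡∣i∣)
open import Data.Integer.Tactic.RingSolver using (solve; solve-∀)
open import Data.List using (_∷_; []; lookup)
open import Data.Nat using (suc)
import Data.Nat.Divisibility as ℕ
open import Data.Product using (_×_; _,_)
open import Function using (_∘_; _$_)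
open import Relation.Binary.PropositionalEquality using (_≡_; refl; sym; trans; cong; cong₂; subst)
open import Relation.Nullary using (¬_)

≡-mod-sym : ∀ {m x y} → x ≡ y [mod m ] → y ≡ x [mod m ]
≡-mod-sym {m} {x} {y} = subst (m ℕ.∣_) (trans (sym (∣-i∣≡∣i∣ (x - y))) (cong ∣_∣ (neg-difference x y)))
  where
  neg-difference : ∀ x y → - (x - y) ≡ y - x
  neg-difference = solve-∀

square≡∣∣² : ∀ z → z * z ≡ + ∣ z ∣ * + ∣ z ∣
square≡∣∣² (+ n)    = refl
square≡∣∣² -[1+ n ] = refl

[-1]^n≡1-2n²[mod8] : ∀ n → + 8 Signed.∣ (- + 1) ^ n - (+ 1 - + 2 * (+ n * + n))
[-1]^n≡1-2n²[mod8] 0             = divides (+ 0) refl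
[-1]^n≡1-2n²[mod8] 1             = divides (+ 0) refl
[-1]^n≡1-2n²[mod8] (suc (suc n)) =
  subst (+ 8 Signed.∣_) (step ((- + 1) ^ n) (+ n))
    (∣m∣n⇒∣m+n ([-1]^n≡1-2n²[mod8] n) (divides (+ n + + 1) refl))
  where
  step : ∀ s N → s - (+ 1 - + 2 * (N * N)) + (N + + 1) * + 8
               ≡ - + 1 * (- + 1 * s) - (+ 1 - + 2 * ((+ 2 + N) * (+ 2 + N)))
  step = solve-∀

negOnePow≡1-2z² : ∀ z → negOnePow z ≡ + 1 - + 2 * (z * z) [mod 8 ]
negOnePow≡1-2z² z rewrite square≡∣∣² z = ∣⇒∣ᵤ ([-1]^n≡1-2n²[mod8] ∣ z ∣)

odd²≡1[mod8] : ∀ n → ¬ 2 ℕ.∣ n → + 8 Signed.∣ + n * + n - + 1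
odd²≡1[mod8] 0 2∤0 with () ← 2∤0 (2 ℕ.∣0)
odd²≡1[mod8] 1 _   = divides (+ 0) refl
odd²≡1[mod8] 2 2∤2 with () ← 2∤2 ℕ.∣-refl
odd²≡1[mod8] 3 _   = divides (+ 1) refl
odd²≡1[mod8] (suc (suc (suc (suc n)))) 2∤4+n =
  subst (+ 8 Signed.∣_) (step (+ n))
    (∣m∣n⇒∣m+n (odd²≡1[mod8] n (2∤4+n ∘ ℕ.∣m∣n⇒∣m+n (ℕ.divides 2 refl))) (divides (+ n + + 2) refl))
  where
  step : ∀ N → N * N - + 1 + (N + + 2) * + 8 ≡ (+ 4 + N) * (+ 4 + N) - + 1
  step = solve-∀

odd-square≡1 : ∀ (d : ℤ) → ¬ (+ 2 ∣ d) → (d * d) ≡ + 1 [mod 8 ]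
odd-square≡1 d 2∤d rewrite square≡∣∣² d = ∣⇒∣ᵤ (odd²≡1[mod8] ∣ d ∣ 2∤d)

x²-z²-2xz≡negOnePow : ∀ (x z : ℤ) → ¬ (x ≡ z [mod 2 ]) →
  (x * x - z * z - + 2 * (x * z)) ≡ negOnePow z [mod 8 ]
x²-z²-2xz≡negOnePow x z x≢z =
  ∣⇒∣ᵤ (subst (+ 8 Signed.∣_) (split x z (negOnePow z)) (∣m∣n⇒∣m-n odd-square square-parity))
  where
  odd-square : + 8 Signed.∣ (x - z) * (x - z) - + 1
  odd-square = ∣ᵤ⇒∣ (odd-square≡1 (x - z) x≢z)
  square-parity : + 8 Signed.∣ negOnePow z - (+ 1 - + 2 * (z * z))
  square-parity = ∣ᵤ⇒∣ (negOnePow≡1-2z² z)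
  split : ∀ x z s → (x - z) * (x - z) - + 1 - (s - (+ 1 - + 2 * (z * z)))
                  ≡ x * x - z * z - + 2 * (x * z) - s
  split = solve-∀

⟨⟩-cong : ∀ {x0 x1 x2 x3 y0 y1 y2 y3} → x0 ≡ y0 → x1 ≡ y1 → x2 ≡ y2 → x3 ≡ y3 →
  ⟨ x0 , x1 , x2 , x3 ⟩ ≡ ⟨ y0 , y1 , y2 , y3 ⟩
⟨⟩-cong refl refl refl refl = refl

ι-⊗ : ∀ n x → ι n ⊗ x ≡ ⟨ n * r0 x , n * r1 x , n * r2 x , n * r3 x ⟩
ι-⊗ n ⟨ x0 , x1 , x2 , x3 ⟩ =
  ⟨⟩-cong (e0 n x0 x1 x2 x3) (e1 n x0 x1 x2 x3) (e2 n x0 x1 x2 x3) (e3 n x0 x1 x2 x3)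
  where
  e0 : ∀ n x0 x1 x2 x3 → n * x0 - (+ 0 * x3 + + 0 * x2 + + 0 * x1) ≡ n * x0
  e0 = solve-∀
  e1 : ∀ n x0 x1 x2 x3 → n * x1 + + 0 * x0 - (+ 0 * x3 + + 0 * x2) ≡ n * x1
  e1 = solve-∀
  e2 : ∀ n x0 x1 x2 x3 → n * x2 + + 0 * x1 + + 0 * x0 - + 0 * x3 ≡ n * x2
  e2 = solve-∀
  e3 : ∀ n x0 x1 x2 x3 → n * x3 + + 0 * x2 + + 0 * x1 + + 0 * x0 ≡ n * x3
  e3 = solve-∀

-- Keeping the partial sum as an explicit record lets a chain of these steps unfold evalF
-- into coordinates that the ring solver, which only reads syntax, can see.
⊕-ι⊗ : ∀ n {p r s0 s1 s2 s3} → r ≡ ⟨ s0 , s1 , s2 , s3 ⟩ →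
  ι n ⊗ p ⊕ r ≡ ⟨ n * r0 p + s0 , n * r1 p + s1 , n * r2 p + s2 , n * r3 p + s3 ⟩
⊕-ι⊗ n {p} refl = cong (_⊕ _) (ι-⊗ n p)

-- The automorphism ζ₈ ↦ ζ₈⁵ = -ζ₈ of ℤ[ζ₈].
σ₅ : ℤζ₈ → ℤζ₈
σ₅ ⟨ x0 , x1 , x2 , x3 ⟩ = ⟨ x0 , - x1 , x2 , - x3 ⟩

evalF-ζ₈ : ∀ a → evalF a ζ₈ ≡ ⟨ c₀ a , c₁ a , c₂ a , c₃ a ⟩
evalF-ζ₈ a = coordinates (a (# 0)) (a (# 1)) (a (# 2)) (a (# 3)) (a (# 4)) (a (# 5)) (a (# 6)) (a (# 7))
                       (a (# 8)) (a (# 9)) (a (# 10)) (a (# 11)) (a (# 12)) (a (# 13)) (a (# 14)) (a (# 15))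
  where
  -- The cₖ are spelled out: c₀ (lookup …) would reach the solver only partly unfolded.
  coordinates : ∀ a0 a1 a2 a3 a4 a5 a6 a7 a8 a9 a10 a11 a12 a13 a14 a15 →
    evalF (lookup (a0 ∷ a1 ∷ a2 ∷ a3 ∷ a4 ∷ a5 ∷ a6 ∷ a7 ∷ a8 ∷ a9 ∷ a10 ∷ a11 ∷ a12 ∷ a13 ∷ a14 ∷ a15 ∷ [])) ζ₈
      ≡ ⟨ a0 + a8 - (a4 + a12) , a1 + a9 - (a5 + a13) , a2 + a10 - (a6 + a14) , a3 + a11 - (a7 + a15) ⟩
  coordinates a0 a1 a2 a3 a4 a5 a6 a7 a8 a9 a10 a11 a12 a13 a14 a15 =
    trans (⊕-ι⊗ a0 $ ⊕-ι⊗ a1 $ ⊕-ι⊗ a2 $ ⊕-ι⊗ a3 $ ⊕-ι⊗ a4 $ ⊕-ι⊗ a5 $ ⊕-ι⊗ a6 $ ⊕-ι⊗ a7 $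
           ⊕-ι⊗ a8 $ ⊕-ι⊗ a9 $ ⊕-ι⊗ a10 $ ⊕-ι⊗ a11 $ ⊕-ι⊗ a12 $ ⊕-ι⊗ a13 $ ⊕-ι⊗ a14 $ ⊕-ι⊗ a15 refl)
          (⟨⟩-cong (solve xs) (solve xs) (solve xs) (solve xs))
    where xs = a0 ∷ a1 ∷ a2 ∷ a3 ∷ a4 ∷ a5 ∷ a6 ∷ a7 ∷ a8 ∷ a9 ∷ a10 ∷ a11 ∷ a12 ∷ a13 ∷ a14 ∷ a15 ∷ []

evalF-ζ₈⁵ : ∀ a → evalF a (pow ζ₈ 5) ≡ σ₅ ⟨ c₀ a , c₁ a , c₂ a , c₃ a ⟩
evalF-ζ₈⁵ a = coordinates (a (# 0)) (a (# 1)) (a (# 2)) (a (# 3)) (a (# 4)) (a (# 5)) (a (# 6)) (a (# 7))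
                       (a (# 8)) (a (# 9)) (a (# 10)) (a (# 11)) (a (# 12)) (a (# 13)) (a (# 14)) (a (# 15))
  where
  coordinates : ∀ a0 a1 a2 a3 a4 a5 a6 a7 a8 a9 a10 a11 a12 a13 a14 a15 →
    evalF (lookup (a0 ∷ a1 ∷ a2 ∷ a3 ∷ a4 ∷ a5 ∷ a6 ∷ a7 ∷ a8 ∷ a9 ∷ a10 ∷ a11 ∷ a12 ∷ a13 ∷ a14 ∷ a15 ∷ [])) (pow ζ₈ 5)
      ≡ ⟨ a0 + a8 - (a4 + a12) , - (a1 + a9 - (a5 + a13)) , a2 + a10 - (a6 + a14) , - (a3 + a11 - (a7 + a15)) ⟩
  coordinates a0 a1 a2 a3 a4 a5 a6 a7 a8 a9 a10 a11 a12 a13 a14 a15 =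
    trans (⊕-ι⊗ a0 $ ⊕-ι⊗ a1 $ ⊕-ι⊗ a2 $ ⊕-ι⊗ a3 $ ⊕-ι⊗ a4 $ ⊕-ι⊗ a5 $ ⊕-ι⊗ a6 $ ⊕-ι⊗ a7 $
           ⊕-ι⊗ a8 $ ⊕-ι⊗ a9 $ ⊕-ι⊗ a10 $ ⊕-ι⊗ a11 $ ⊕-ι⊗ a12 $ ⊕-ι⊗ a13 $ ⊕-ι⊗ a14 $ ⊕-ι⊗ a15 refl)
          (⟨⟩-cong (solve xs) (solve xs) (solve xs) (solve xs))
    where xs = a0 ∷ a1 ∷ a2 ∷ a3 ∷ a4 ∷ a5 ∷ a6 ∷ a7 ∷ a8 ∷ a9 ∷ a10 ∷ a11 ∷ a12 ∷ a13 ∷ a14 ∷ a15 ∷ []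

Re-⊗σ₅ : ∀ x0 x1 x2 x3 →
  Re (⟨ x0 , x1 , x2 , x3 ⟩ ⊗ σ₅ ⟨ x0 , x1 , x2 , x3 ⟩) ≡ x0 * x0 - x2 * x2 + + 2 * (x1 * x3)
Re-⊗σ₅ = expanded
  where
  expanded : ∀ x0 x1 x2 x3 →
    x0 * x0 - (x1 * - x3 + x2 * x2 + x3 * - x1) ≡ x0 * x0 - x2 * x2 + + 2 * (x1 * x3)
  expanded = solve-∀

Im-⊗σ₅ : ∀ x0 x1 x2 x3 →
  Im (⟨ x0 , x1 , x2 , x3 ⟩ ⊗ σ₅ ⟨ x0 , x1 , x2 , x3 ⟩) ≡ + 2 * (x0 * x2) - x1 * x1 + x3 * x3
Im-⊗σ₅ = expanded
  where
  expanded : ∀ x0 x1 x2 x3 →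
    x0 * x2 + x1 * - x1 + x2 * x0 - x3 * - x3 ≡ + 2 * (x0 * x2) - x1 * x1 + x3 * x3
  expanded = solve-∀

α₂≡⊗σ₅ : ∀ a → α₂ a ≡ ⟨ c₀ a , c₁ a , c₂ a , c₃ a ⟩ ⊗ σ₅ ⟨ c₀ a , c₁ a , c₂ a , c₃ a ⟩
α₂≡⊗σ₅ a = cong₂ _⊗_ (evalF-ζ₈ a) (evalF-ζ₈⁵ a)

Re-α₂ : ∀ a → Re (α₂ a) ≡ c₀ a * c₀ a - c₂ a * c₂ a + + 2 * (c₁ a * c₃ a)
Re-α₂ a = trans (cong Re (α₂≡⊗σ₅ a)) (Re-⊗σ₅ (c₀ a) (c₁ a) (c₂ a) (c₃ a))

Im-α₂ : ∀ a → Im (α₂ a) ≡ + 2 * (c₀ a * c₂ a) - c₁ a * c₁ a + c₃ a * c₃ a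
Im-α₂ a = trans (cong Im (α₂≡⊗σ₅ a)) (Im-⊗σ₅ (c₀ a) (c₁ a) (c₂ a) (c₃ a))

Re-congruence : ∀ c0 c1 c2 c3 → ¬ (c0 ≡ c2 [mod 2 ]) →
  (c0 * c0 - c2 * c2 + + 2 * (c1 * c3)) ≡ negOnePow c2 + + 2 * (c0 * c2 + c1 * c3) [mod 8 ]
Re-congruence c0 c1 c2 c3 c0≢c2 =
  subst (+ 8 ∣_) (shift (negOnePow c2)) (x²-z²-2xz≡negOnePow c0 c2 c0≢c2)
  where
  shift : ∀ s → c0 * c0 - c2 * c2 - + 2 * (c0 * c2) - s
              ≡ c0 * c0 - c2 * c2 + + 2 * (c1 * c3) - (s + + 2 * (c0 * c2 + c1 * c3))
  shift s = solve (c0 ∷ c1 ∷ c2 ∷ c3 ∷ s ∷ [])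

Im-congruence : ∀ c0 c1 c2 c3 → ¬ (c1 ≡ c3 [mod 2 ]) →
  (+ 2 * (c0 * c2) - c1 * c1 + c3 * c3) ≡ negOnePow c1 + + 2 * (c0 * c2 + c1 * c3) [mod 8 ]
Im-congruence c0 c1 c2 c3 c1≢c3 =
  subst (+ 8 ∣_) (shift (negOnePow c1)) (x²-z²-2xz≡negOnePow c3 c1 (c1≢c3 ∘ ≡-mod-sym {x = c3} {y = c1}))
  where
  shift : ∀ s → c3 * c3 - c1 * c1 - + 2 * (c3 * c1) - s
              ≡ + 2 * (c0 * c2) - c1 * c1 + c3 * c3 - (s + + 2 * (c0 * c2 + c1 * c3))
  shift s = solve (c0 ∷ c1 ∷ c2 ∷ c3 ∷ s ∷ [])

lemma4p3 : (a : Fin 16 → ℤ) →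
    ¬ (c₀ a ≡ c₂ a [mod 2 ]) → ¬ (c₁ a ≡ c₃ a [mod 2 ]) →
    (Re (α₂ a) ≡ negOnePow (c₂ a) + (+ 2) * (c₀ a * c₂ a + c₁ a * c₃ a) [mod 8 ])
    × (Im (α₂ a) ≡ negOnePow (c₁ a) + (+ 2) * (c₀ a * c₂ a + c₁ a * c₃ a) [mod 8 ])
lemma4p3 a c₀≢c₂ c₁≢c₃ =
  subst (λ t → t ≡ negOnePow (c₂ a) + cross [mod 8 ]) (sym (Re-α₂ a))
    (Re-congruence (c₀ a) (c₁ a) (c₂ a) (c₃ a) c₀≢c₂) ,
  subst (λ t → t ≡ negOnePow (c₁ a) + cross [mod 8 ]) (sym (Im-α₂ a))
    (Im-congruence (c₀ a) (c₁ a) (c₂ a) (c₃ a) c₁≢c₃)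
  where
  cross : ℤ
  cross = + 2 * (c₀ a * c₂ a + c₁ a * c₃ a)
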